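{- Let $f:\mathbb{Z}_{>0}\to\mathbb{C}$ be a multiplicative function such that $f(a^2+b^2+c^2)=f(a^2)+f(b^2)+f(c^2)$ for all positive integers $a,b,c$. Then $f(n)=n$ for $1\le n\le 12$ and for $n=25$.
   Context: A function $f$ on the positive integers is multiplicative if $f(1)=1$ and $f(mn)=f(m)f(n)$ whenever $\gcd(m,n)=1$. -}

module Defs where

open import Level using (Level; _⊔_)
open import Data.Nat using (ℕ; zero; suc; _^_; _≥_) renaming (_*_ to _*ℕ_; _+_ to _+ℕ_)
open import Data.Nat.Coprimality using (Coprime)
open import Data.Product using (Σ; _×_)
open import Relation.Nullary using (¬_)
open import Algebra.Bundles using (CommutativeRing)

module _ {c ℓ : Level} (R : CommutativeRing c ℓ) where
  open CommutativeRing R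

  ι : ℕ → Carrier
  ι zero    = 0#
  ι (suc n) = 1# + ι n

  record IsField : Set (c ⊔ ℓ) where
    field
      nontrivial : ¬ (1# ≈ 0#)
      inverse    : ∀ x → ¬ (x ≈ 0#) → Σ Carrier λ y → x * y ≈ 1#

  CharZero : Set ℓ
  CharZero = ∀ n → ¬ (ι (suc n) ≈ 0#)

  -- f : ℤ_{>0} → R, encoded as a function on ℕ whose value at 0 is ignored.
  -- Multiplicative: f(1) = 1 and f(mn) = f(m) f(n) for coprime positive m, n.
  Multiplicative : (ℕ → Carrier) → Set ℓ
  Multiplicative f =
    (f 1 ≈ 1#) ×
    (∀ m n → m ≥ 1 → n ≥ 1 → Coprime m n → f (m *ℕ n) ≈ f m * f n)

  SumOfThreeSquares : (ℕ → Carrier) → Set ℓ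
  SumOfThreeSquares f =
    ∀ a b c → a ≥ 1 → b ≥ 1 → c ≥ 1 →
      f (a ^ 2 +ℕ b ^ 2 +ℕ c ^ 2) ≈ f (a ^ 2) + f (b ^ 2) + f (c ^ 2)

module Submission where

-- 1. Propagation.  Correctness spreads along the two hypotheses: from the
--    summands of a² + b² + c² to the sum and back to a missing summand
--    (additive cancellation), and from coprime factors to the product and
--    back to a missing factor (nonzero integers are invertible in K).
--
-- 2. The value f(2).  This is the one genuinely nonlinear step: the
--    relations at 6, 9, 11, 18, 22 and 33 give, with x = f(2), a linear
--    combination showing 8x = 16, whence f(2) = 2.
--
-- Starting from f(1) = 1 and f(3) = f(1)+f(1)+f(1), repeated propagation
-- then reaches every n ≤ 12 and 25 (through 4, 9, 11, 16, 21, 24, 27, 30).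

open import Defs
open import Level using (Level)
open import Data.Nat using (ℕ; _≤_; _≥_)
open import Data.Sum using (_⊎_)
open import Data.Product using (_×_)
open import Relation.Binary.PropositionalEquality using (_≡_)
open import Algebra.Bundles using (CommutativeRing)

import Data.Nat as ℕ
open import Data.Nat using (zero; suc; s≤s; _^_; NonZero; >-nonZero⁻¹)
open import Data.Nat.Coprimality using (coprime?)
open import Data.Sum using (inj₁; inj₂)
open import Data.Product using (_,_; proj₁; proj₂)
open import Relation.Nullary.Decidable using (True; toWitness)
import Relation.Binary.PropositionalEquality as ≡

module RingFacts {c ℓ : Level} (K : CommutativeRing c ℓ) where
  open CommutativeRing K
  open import Algebra.Properties.Semiring.Mult semiring
    using (×-homo-+; ×1-homo-*) renaming (_×_ to _·_)
  open import Algebra.Properties.Group +-group using (∙-cancelʳ)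
  open import Relation.Binary.Reasoning.Setoid setoid

  -- ι n is the library's iterated sum n · 1#, so it inherits its laws.
  ι≡·1 : ∀ n → ι K n ≡ n · 1#
  ι≡·1 zero    = ≡.refl
  ι≡·1 (suc n) = ≡.cong (1# +_) (ι≡·1 n)

  ι-homo-+ : ∀ m n → ι K (m ℕ.+ n) ≈ ι K m + ι K n
  ι-homo-+ m n rewrite ι≡·1 (m ℕ.+ n) | ι≡·1 m | ι≡·1 n = ×-homo-+ 1# m n

  ι-homo-+₃ : ∀ l m n → ι K (l ℕ.+ m ℕ.+ n) ≈ ι K l + ι K m + ι K n
  ι-homo-+₃ l m n = trans (ι-homo-+ (l ℕ.+ m) n) (+-congʳ (ι-homo-+ l m))

  ι-homo-* : ∀ m n → ι K (m ℕ.* n) ≈ ι K m * ι K n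
  ι-homo-* m n rewrite ι≡·1 (m ℕ.* n) | ι≡·1 m | ι≡·1 n = ×1-homo-* m n

  unit-cancelˡ : ∀ {u v a b} → v * u ≈ 1# → u * a ≈ u * b → a ≈ b
  unit-cancelˡ {u} {v} {a} {b} vu≈1 ua≈ub = begin
    a            ≈⟨ *-identityˡ a ⟨
    1# * a       ≈⟨ *-congʳ vu≈1 ⟨
    v * u * a    ≈⟨ *-assoc v u a ⟩
    v * (u * a)  ≈⟨ *-congˡ ua≈ub ⟩
    v * (u * b)  ≈⟨ *-assoc v u b ⟨
    v * u * b    ≈⟨ *-congʳ vu≈1 ⟩
    1# * b       ≈⟨ *-identityˡ b ⟩
    b            ∎

  ι-cancelˡ : IsField K → CharZero K →
    ∀ m {{_ : NonZero m}} {a b} → ι K m * a ≈ ι K m * b → a ≈ b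
  ι-cancelˡ isField charZero (suc k) with IsField.inverse isField (ι K (suc k)) (charZero k)
  ... | v , uv≈1 = unit-cancelˡ (trans (*-comm v _) uv≈1)

  -- The only nonlinear step, for arbitrary ring elements x, y₄, y₉, y₁₁, y₁₆
  -- satisfying the relations that x = f(2), yₙ = f(n) satisfy at
  -- 6 = 2·3 = 1+1+4, 9 = 1+4+4, 11 = 1+1+9, 22 = 2·11 = 4+9+9,
  -- 18 = 2·9 = 1+1+16 and 33 = 3·11 = 1+16+16.  With Eₙ = lhs − rhs,
  --   8x − 16 = 4E₆ − E₉ + 3E₁₁ − E₃₃ − 2E₂₂ + 2E₁₈ + 2x·E₁₁.
  -- Free of subtraction: 8x + A = 16 + A′ is a polynomial identity (checked
  -- by the solver), A′ ≈ A by the hypotheses, and A cancels.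
  eight-f2 : ∀ x y₄ y₉ y₁₁ y₁₆ →
    x * ι K 3 ≈ ι K 1 + ι K 1 + y₄ →
    y₉ ≈ ι K 1 + y₄ + y₄ →
    y₁₁ ≈ ι K 1 + ι K 1 + y₉ →
    x * y₁₁ ≈ y₄ + y₉ + y₉ →
    x * y₉ ≈ ι K 1 + ι K 1 + y₁₆ →
    ι K 3 * y₁₁ ≈ ι K 1 + y₁₆ + y₁₆ →
    ι K 8 * x ≈ ι K 8 * ι K 2
  eight-f2 x y₄ y₉ y₁₁ y₁₆ h₆ h₉ h₁₁ h₂₂ h₁₈ h₃₃ = ∙-cancelʳ A _ _ (begin
    ι K 8 * x + A    ≈⟨ identity ⟩
    ι K 8 * ι K 2 + A′
      ≈⟨ +-congˡ (+-cong (+-cong (+-cong (+-cong (+-cong (+-cong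
           (*-congˡ h₆) (sym h₉)) (*-congˡ h₁₁)) (sym h₃₃))
           (*-congˡ (sym h₂₂))) (*-congˡ h₁₈)) (*-congˡ h₁₁)) ⟩
    ι K 8 * ι K 2 + A ∎)
    where
    A A′ : Carrier
    A =
      ι K 4 * (ι K 1 + ι K 1 + y₄) + y₉ + ι K 3 * (ι K 1 + ι K 1 + y₉) + ι K 3 * y₁₁
      + ι K 2 * (x * y₁₁) + ι K 2 * (ι K 1 + ι K 1 + y₁₆) + ι K 2 * x * (ι K 1 + ι K 1 + y₉)
    A′ =
      ι K 4 * (x * ι K 3) + (ι K 1 + y₄ + y₄) + ι K 3 * y₁₁ + (ι K 1 + y₁₆ + y₁₆)
      + ι K 2 * (y₄ + y₉ + y₉) + ι K 2 * (x * y₉) + ι K 2 * x * y₁₁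

    open import Algebra.Solver.Ring.NaturalCoefficients.Default commutativeSemiring

    ι′ : ∀ {k} → ℕ → Polynomial k
    ι′ zero    = con 0
    ι′ (suc n) = con 1 :+ ι′ n

    identity : ι K 8 * x + A ≈ ι K 8 * ι K 2 + A′
    identity = solve 5 (λ x y₄ y₉ y₁₁ y₁₆ →
      ι′ 8 :* x :+ (ι′ 4 :* (ι′ 1 :+ ι′ 1 :+ y₄) :+ y₉ :+ ι′ 3 :* (ι′ 1 :+ ι′ 1 :+ y₉) :+ ι′ 3 :* y₁₁
        :+ ι′ 2 :* (x :* y₁₁) :+ ι′ 2 :* (ι′ 1 :+ ι′ 1 :+ y₁₆) :+ ι′ 2 :* x :* (ι′ 1 :+ ι′ 1 :+ y₉))
      := ι′ 8 :* ι′ 2 :+ (ι′ 4 :* (x :* ι′ 3) :+ (ι′ 1 :+ y₄ :+ y₄) :+ ι′ 3 :* y₁₁ :+ (ι′ 1 :+ y₁₆ :+ y₁₆)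
        :+ ι′ 2 :* (y₄ :+ y₉ :+ y₉) :+ ι′ 2 :* (x :* y₉) :+ ι′ 2 :* x :* y₁₁)) refl x y₄ y₉ y₁₁ y₁₆

module SmallValues {c ℓ : Level} (K : CommutativeRing c ℓ)
  (isField : IsField K) (charZero : CharZero K)
  (f : ℕ → CommutativeRing.Carrier K)
  (multiplicative : Multiplicative K f) (squares : SumOfThreeSquares K f) where

  open CommutativeRing K
  open RingFacts K
  open import Algebra.Properties.Group +-group using (∙-cancelˡ)
  open import Relation.Binary.Reasoning.Setoid setoid

  Correct : ℕ → Set ℓ
  Correct n = f n ≈ ι K n

  positive : ∀ n {{_ : NonZero n}} → n ≥ 1
  positive n = >-nonZero⁻¹ n

  squares-rel : ∀ a b c {{_ : NonZero a}} {{_ : NonZero b}} {{_ : NonZero c}} →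
    f (a ^ 2 ℕ.+ b ^ 2 ℕ.+ c ^ 2) ≈ f (a ^ 2) + f (b ^ 2) + f (c ^ 2)
  squares-rel a b c = squares a b c (positive a) (positive b) (positive c)

  product-rel : ∀ m n {{_ : NonZero m}} {{_ : NonZero n}} {cop : True (coprime? m n)} →
    f (m ℕ.* n) ≈ f m * f n
  product-rel m n {cop = cop} = proj₂ multiplicative m n (positive m) (positive n) (toWitness cop)

  correct-1 : Correct 1
  correct-1 = trans (proj₁ multiplicative) (sym (+-identityʳ 1#))

  correct-sum : ∀ a b c {{_ : NonZero a}} {{_ : NonZero b}} {{_ : NonZero c}} →
    Correct (a ^ 2) → Correct (b ^ 2) → Correct (c ^ 2) →
    Correct (a ^ 2 ℕ.+ b ^ 2 ℕ.+ c ^ 2)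
  correct-sum a b c ca cb cc = begin
    f (a ^ 2 ℕ.+ b ^ 2 ℕ.+ c ^ 2)        ≈⟨ squares-rel a b c ⟩
    f (a ^ 2) + f (b ^ 2) + f (c ^ 2)    ≈⟨ +-cong (+-cong ca cb) cc ⟩
    ι K (a ^ 2) + ι K (b ^ 2) + ι K (c ^ 2)
      ≈⟨ ι-homo-+₃ (a ^ 2) (b ^ 2) (c ^ 2) ⟨
    ι K (a ^ 2 ℕ.+ b ^ 2 ℕ.+ c ^ 2)      ∎

  correct-summand : ∀ a b c {{_ : NonZero a}} {{_ : NonZero b}} {{_ : NonZero c}} →
    Correct (a ^ 2 ℕ.+ b ^ 2 ℕ.+ c ^ 2) → Correct (a ^ 2) → Correct (b ^ 2) →
    Correct (c ^ 2)
  correct-summand a b c cs ca cb = ∙-cancelˡ (ι K (a ^ 2) + ι K (b ^ 2)) _ _ (begin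
    ι K (a ^ 2) + ι K (b ^ 2) + f (c ^ 2)  ≈⟨ +-congʳ (+-cong ca cb) ⟨
    f (a ^ 2) + f (b ^ 2) + f (c ^ 2)      ≈⟨ squares-rel a b c ⟨
    f (a ^ 2 ℕ.+ b ^ 2 ℕ.+ c ^ 2)          ≈⟨ cs ⟩
    ι K (a ^ 2 ℕ.+ b ^ 2 ℕ.+ c ^ 2)
      ≈⟨ ι-homo-+₃ (a ^ 2) (b ^ 2) (c ^ 2) ⟩
    ι K (a ^ 2) + ι K (b ^ 2) + ι K (c ^ 2) ∎)

  correct-product : ∀ m n {{_ : NonZero m}} {{_ : NonZero n}} {cop : True (coprime? m n)} →
    Correct m → Correct n → Correct (m ℕ.* n)
  correct-product m n {cop = cop} cm cn = begin
    f (m ℕ.* n)    ≈⟨ product-rel m n {cop = cop} ⟩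
    f m * f n      ≈⟨ *-cong cm cn ⟩
    ι K m * ι K n  ≈⟨ ι-homo-* m n ⟨
    ι K (m ℕ.* n)  ∎

  correct-factor : ∀ m n {{_ : NonZero m}} {{_ : NonZero n}} {cop : True (coprime? m n)} →
    Correct (m ℕ.* n) → Correct m → Correct n
  correct-factor m n {cop = cop} cmn cm = ι-cancelˡ isField charZero m (begin
    ι K m * f n    ≈⟨ *-congʳ cm ⟨
    f m * f n      ≈⟨ product-rel m n {cop = cop} ⟨
    f (m ℕ.* n)    ≈⟨ cmn ⟩
    ι K (m ℕ.* n)  ≈⟨ ι-homo-* m n ⟩
    ι K m * ι K n  ∎)

  correct-3 : Correct 3
  correct-3 = correct-sum 1 1 1 correct-1 correct-1 correct-1

  correct-2 : Correct 2
  correct-2 = ι-cancelˡ isField charZero 8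
    (eight-f2 (f 2) (f 4) (f 9) (f 11) (f 16) r₆ r₉ r₁₁ r₂₂ r₁₈ r₃₃)
    where
    one-one : ∀ {y} → f 1 + f 1 + y ≈ ι K 1 + ι K 1 + y
    one-one = +-congʳ (+-cong correct-1 correct-1)

    one : ∀ {y z} → f 1 + y + z ≈ ι K 1 + y + z
    one = +-congʳ (+-congʳ correct-1)

    r₆ : f 2 * ι K 3 ≈ ι K 1 + ι K 1 + f 4
    r₆ = begin
      f 2 * ι K 3        ≈⟨ *-congˡ correct-3 ⟨
      f 2 * f 3          ≈⟨ product-rel 2 3 ⟨
      f 6                ≈⟨ squares-rel 1 1 2 ⟩
      f 1 + f 1 + f 4    ≈⟨ one-one ⟩
      ι K 1 + ι K 1 + f 4 ∎

    r₉ : f 9 ≈ ι K 1 + f 4 + f 4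
    r₉ = trans (squares-rel 1 2 2) one

    r₁₁ : f 11 ≈ ι K 1 + ι K 1 + f 9
    r₁₁ = trans (squares-rel 1 1 3) one-one

    r₂₂ : f 2 * f 11 ≈ f 4 + f 9 + f 9
    r₂₂ = trans (sym (product-rel 2 11)) (squares-rel 2 3 3)

    r₁₈ : f 2 * f 9 ≈ ι K 1 + ι K 1 + f 16
    r₁₈ = trans (sym (product-rel 2 9)) (trans (squares-rel 1 1 4) one-one)

    r₃₃ : ι K 3 * f 11 ≈ ι K 1 + f 16 + f 16
    r₃₃ = begin
      ι K 3 * f 11         ≈⟨ *-congʳ correct-3 ⟨
      f 3 * f 11           ≈⟨ product-rel 3 11 ⟨
      f 33                 ≈⟨ squares-rel 1 4 4 ⟩
      f 1 + f 16 + f 16    ≈⟨ one ⟩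
      ι K 1 + f 16 + f 16  ∎

  correct-6 : Correct 6
  correct-6 = correct-product 2 3 correct-2 correct-3

  correct-4 : Correct 4
  correct-4 = correct-summand 1 1 2 correct-6 correct-1 correct-1

  correct-9 : Correct 9
  correct-9 = correct-sum 1 2 2 correct-1 correct-4 correct-4

  correct-11 : Correct 11
  correct-11 = correct-sum 1 1 3 correct-1 correct-1 correct-9

  correct-16 : Correct 16            -- 2·9 = 18 = 1² + 1² + 4²
  correct-16 = correct-summand 1 1 4 (correct-product 2 9 correct-2 correct-9) correct-1 correct-1

  correct-25 : Correct 25            -- 3² + 3² + 3² = 27 = 1² + 1² + 5²
  correct-25 = correct-summand 1 1 5 (correct-sum 3 3 3 correct-9 correct-9 correct-9) correct-1 correct-1

  correct-7 : Correct 7              -- 3·7 = 21 = 1² + 2² + 4²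
  correct-7 = correct-factor 3 7 (correct-sum 1 2 4 correct-1 correct-4 correct-16) correct-3

  correct-8 : Correct 8              -- 3·8 = 24 = 2² + 2² + 4²
  correct-8 = correct-factor 3 8 (correct-sum 2 2 4 correct-4 correct-4 correct-16) correct-3

  correct-5 : Correct 5              -- 6·5 = 30 = 1² + 2² + 5²
  correct-5 = correct-factor 6 5 (correct-sum 1 2 5 correct-1 correct-4 correct-25) correct-6

  correct-10 : Correct 10
  correct-10 = correct-product 2 5 correct-2 correct-5

  correct-12 : Correct 12
  correct-12 = correct-product 4 3 correct-4 correct-3

  correct-in-range : ∀ n → ((1 ≤ n × n ≤ 12) ⊎ n ≡ 25) → Correct n
  correct-in-range _  (inj₂ ≡.refl) = correct-25
  correct-in-range 0  (inj₁ (() , _))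
  correct-in-range 1  (inj₁ _) = correct-1
  correct-in-range 2  (inj₁ _) = correct-2
  correct-in-range 3  (inj₁ _) = correct-3
  correct-in-range 4  (inj₁ _) = correct-4
  correct-in-range 5  (inj₁ _) = correct-5
  correct-in-range 6  (inj₁ _) = correct-6
  correct-in-range 7  (inj₁ _) = correct-7
  correct-in-range 8  (inj₁ _) = correct-8
  correct-in-range 9  (inj₁ _) = correct-9
  correct-in-range 10 (inj₁ _) = correct-10
  correct-in-range 11 (inj₁ _) = correct-11
  correct-in-range 12 (inj₁ _) = correct-12
  correct-in-range (suc (suc (suc (suc (suc (suc (suc (suc (suc (suc (suc (suc (suc _)))))))))))))
    (inj₁ (_ , s≤s (s≤s (s≤s (s≤s (s≤s (s≤s (s≤s (s≤s (s≤s (s≤s (s≤s (s≤s (()))))))))))))))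

mainTheorem2 : {c ℓ : Level} (K : CommutativeRing c ℓ) → IsField K → CharZero K →
    (f : ℕ → CommutativeRing.Carrier K) →
    Multiplicative K f → SumOfThreeSquares K f →
    ∀ n → ((1 ≤ n × n ≤ 12) ⊎ n ≡ 25) → CommutativeRing._≈_ K (f n) (ι K n)
mainTheorem2 K isField charZero f multiplicative squares =
  SmallValues.correct-in-range K isField charZero f multiplicative squares
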